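{- Let $N$ be a net, and let $\sigma_1,\sigma_2\in\mathrm{FS}(N)$ and $\sigma_3\in\mathrm{FS}^\infty(N)$ with $\sigma_1\equiv_0^*\sigma_2\le\sigma_3$. Then there is $\sigma'\in\mathrm{FS}^\infty(N)$ with $\sigma_1\le\sigma'\equiv_0^*\sigma_3$. Moreover, if $\sigma_3\in\mathrm{FS}(N)$ then $\sigma'\in\mathrm{FS}(N)$.
   Context: A net is $N=(S,T,F,M_0)$ with $S,T$ disjoint, $F:(S\times T)\cup(T\times S)\to\mathbb{N}$, $M_0:S\to\mathbb{N}$, each transition having finitely many and at least one preplace and finitely many postplaces. ${}^\bullet x(y)=F(y,x)$, $x^\bullet(y)=F(x,y)$, extended additively to finite multisets. For markings $M,M'$ and finite non-empty multiset $G$ of transitions, $M\xrightarrow{G}M'$ iff ${}^\bullet G\le M$ and $M'=(M-{}^\bullet G)+G^\bullet$. For a finite or infinite word $\sigma=t_1t_2\cdots$, $M\xrightarrow{\sigma}$ means $M\xrightarrow{\{t_1\}}M_1\xrightarrow{\{t_2\}}\cdots$. $\mathrm{FS}^\infty(N)$: words with $M_0\xrightarrow{\sigma}$; $\mathrm{FS}(N)$: finite ones. $\le$ is the prefix order. For $\sigma,\rho\in\mathrm{FS}^\infty(N)$, $\sigma\equiv_0\rho$ iff $\sigma=\alpha tu\beta$, $\rho=\alpha ut\beta$ and $M_0\xrightarrow{\alpha}M\xrightarrow{\{t,u\}}$ for some $M$; $\equiv_0^*$ is the reflexive transitive closure of $\equiv_0$ on $\mathrm{FS}^\infty(N)$.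 -}

module Defs where

open import Data.Nat using (ℕ; zero; suc; _+_; _∸_; _≤_)
open import Data.List using (List; []; _∷_; map)
open import Data.Nat.ListAction using (sum)
open import Data.List.Membership.Propositional using (_∈_)
open import Data.Maybe using (Maybe; just; nothing)
open import Data.Product using (Σ; ∃; _×_; _,_)
open import Relation.Binary.PropositionalEquality using (_≡_; _≢_; refl)

-- A net N = (S, T, F, M₀).  S and T are separate types, hence disjoint.
-- F is split into its two halves: pre s t = F(s,t), post t s = F(t,s).
record Net : Set₁ where
  field
    S    : Set
    T    : Set
    pre  : S → T → ℕ
    post : T → S → ℕ
    M₀   : S → ℕ
    preFinite  : ∀ t → Σ (List S) λ ps → ∀ s → pre s t ≢ 0 → s ∈ ps
    preNonEmpty : ∀ t → Σ S λ s → pre s t ≢ 0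
    postFinite : ∀ t → Σ (List S) λ ps → ∀ s → post t s ≢ 0 → s ∈ ps

-- Finite or infinite words over an alphabet A: a position-indexed
-- sequence that, once it has ended (nothing), stays ended.
record Word (A : Set) : Set where
  constructor mkWord
  field
    at     : ℕ → Maybe A
    closed : ∀ i → at i ≡ nothing → at (suc i) ≡ nothing
open Word public

_≈ʷ_ : ∀ {A} → Word A → Word A → Set
σ ≈ʷ ρ = ∀ i → at σ i ≡ at ρ i

_≤ʷ_ : ∀ {A} → Word A → Word A → Set
σ ≤ʷ ρ = ∀ i x → at σ i ≡ just x → at ρ i ≡ just x

Finite : ∀ {A} → Word A → Set
Finite σ = ∃ λ n → at σ n ≡ nothing

private
  catAt : ∀ {A} → List A → Word A → ℕ → Maybe A
  catAt []      β i       = at β i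
  catAt (x ∷ α) β zero    = just x
  catAt (x ∷ α) β (suc i) = catAt α β i

  catClosed : ∀ {A} (α : List A) (β : Word A) i →
              catAt α β i ≡ nothing → catAt α β (suc i) ≡ nothing
  catClosed []      β i       e  = closed β i e
  catClosed (x ∷ α) β zero    ()
  catClosed (x ∷ α) β (suc i) e  = catClosed α β i e

_⊙_ : ∀ {A} → List A → Word A → Word A
α ⊙ β = mkWord (catAt α β) (catClosed α β)

infixr 5 _⊙_

module _ (N : Net) where
  open Net N

  Marking : Set
  Marking = S → ℕ

  -- finite multisets of transitions, represented as lists (order irrelevant
  -- for ᵒG and Gᵒ, which are additive)
  preM : List T → Marking
  preM G s = sum (map (pre s) G)

  postM : List T → Marking
  postM G s = sum (map (λ t → post t s) G)

  -- M [G⟩ M'   (G a finite non-empty multiset, given as a non-empty list)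
  Step : Marking → (t : T) → (G : List T) → Marking → Set
  Step M t G M' = (∀ s → preM (t ∷ G) s ≤ M s)
                × (∀ s → M' s ≡ (M s ∸ preM (t ∷ G) s) + postM (t ∷ G) s)

  data Run : Marking → List T → Marking → Set where
    run[] : ∀ {M M'} → (∀ s → M s ≡ M' s) → Run M [] M'
    run∷  : ∀ {M M' M'' t α} → Step M t [] M' → Run M' α M'' → Run M (t ∷ α) M''

  Fires : Marking → Word T → Set
  Fires M σ = Σ (ℕ → Marking) λ Ms →
                (∀ s → Ms 0 s ≡ M s)
              × (∀ i t → at σ i ≡ just t → Step (Ms i) t [] (Ms (suc i)))

  FS∞ : Word T → Set
  FS∞ σ = Fires M₀ σ

  FS : Word T → Set
  FS σ = FS∞ σ × Finite σ

  _≡₀_ : Word T → Word T → Set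
  σ ≡₀ ρ = FS∞ σ × FS∞ ρ ×
    Σ (List T) λ α → Σ T λ t → Σ T λ u → Σ (Word T) λ β →
      (σ ≈ʷ (α ⊙ (t ∷ u ∷ []) ⊙ β)) ×
      (ρ ≈ʷ (α ⊙ (u ∷ t ∷ []) ⊙ β)) ×
      Σ Marking λ M → Run M₀ α M × Σ Marking λ M' → Step M t (u ∷ []) M'

  -- reflexive transitive closure of ≡₀ on FS∞(N) (reflexivity up to
  -- pointwise equality of words)
  data _≡₀*_ : Word T → Word T → Set where
    refl* : ∀ {σ ρ} → FS∞ σ → σ ≈ʷ ρ → σ ≡₀* ρ
    step* : ∀ {σ ρ τ} → σ ≡₀ ρ → ρ ≡₀* τ → σ ≡₀* τ

{-# OPTIONS --safe #-}
-- The witness is σ₁ ◁ σ₃: σ₁ continued by the letters of σ₃ beyond the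
-- length of σ₁.  A ≡₀-step exchanges two adjacent letters without changing
-- which positions are occupied, so overlaying a word τ commutes with it; the
-- overlaid word still fires because two concurrently enabled transitions
-- fire in either order to the same marking.  Walking the chain
-- σ₁ ≡₀* σ₂ backwards from σ₂ ◁ σ₃ = σ₃ gives σ₁ ◁ σ₃ ≡₀* σ₃.
module Submission where

open import Defs
open import Data.Product using (Σ; _×_; _,_; proj₁)
open import Data.Nat using (ℕ; zero; suc; _+_; _∸_; _≤_)
open import Data.Nat.Properties
  using ( +-comm; +-identityʳ; +-∸-comm; ∸-+-assoc; m+n≤o⇒m≤o; m+n≤o⇒m≤o∸n; m≤m+n
        ; ≤-trans; ≤-reflexive; +-commutativeSemigroup)
open import Algebra.Properties.CommutativeSemigroup +-commutativeSemigroup using (xy∙z≈xz∙y)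
open import Data.List using (List; []; _∷_; length)
open import Data.Maybe using (just; nothing; _<∣>_)
open import Relation.Binary.PropositionalEquality

m+n≤o⇒n≤o∸m : ∀ m {n o} → m + n ≤ o → n ≤ o ∸ m
m+n≤o⇒n≤o∸m m {n} m+n≤o = m+n≤o⇒m≤o∸n n (≤-trans (≤-reflexive (+-comm n m)) m+n≤o)

o∸n+q∸m+p≡o∸m+p∸n+q : ∀ {m n o} p q → m + n ≤ o → o ∸ n + q ∸ m + p ≡ o ∸ m + p ∸ n + q
o∸n+q∸m+p≡o∸m+p∸n+q {m} {n} {o} p q m+n≤o = begin
  o ∸ n + q ∸ m + p  ≡⟨ cong (_+ p) (+-∸-comm q (m+n≤o⇒m≤o∸n m m+n≤o)) ⟩
  o ∸ n ∸ m + q + p  ≡⟨ cong (λ x → x + q + p) o∸n∸m≡o∸m∸n ⟩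
  o ∸ m ∸ n + q + p  ≡⟨ xy∙z≈xz∙y (o ∸ m ∸ n) q p ⟩
  o ∸ m ∸ n + p + q  ≡⟨ cong (_+ q) (+-∸-comm p (m+n≤o⇒n≤o∸m m m+n≤o)) ⟨
  o ∸ m + p ∸ n + q  ∎
  where
  open ≡-Reasoning
  o∸n∸m≡o∸m∸n : o ∸ n ∸ m ≡ o ∸ m ∸ n
  o∸n∸m≡o∸m∸n = trans (∸-+-assoc o n m) (trans (cong (o ∸_) (+-comm n m)) (sym (∸-+-assoc o m n)))

module _ {A : Set} where

  ≈ʷ-sym : {σ ρ : Word A} → σ ≈ʷ ρ → ρ ≈ʷ σ
  ≈ʷ-sym σ≈ρ i = sym (σ≈ρ i)

  at-nothing-+ : ∀ (w : Word A) {n} k → at w n ≡ nothing → at w (k + n) ≡ nothing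
  at-nothing-+ w zero    wn = wn
  at-nothing-+ w {n} (suc k) wn = closed w (k + n) (at-nothing-+ w k wn)

  infixl 25 _◁_

  _◁_ : Word A → Word A → Word A
  σ ◁ τ = mkWord (λ i → at σ i <∣> at τ i) closed-◁
    where
    closed-◁ : ∀ i → at σ i <∣> at τ i ≡ nothing → at σ (suc i) <∣> at τ (suc i) ≡ nothing
    closed-◁ i e with at σ i in σi
    closed-◁ i () | just _
    ... | nothing rewrite closed σ i σi = closed τ i e

  tailʷ : Word A → Word A
  tailʷ w = mkWord (λ i → at w (suc i)) (λ i → closed w (suc i))

  dropʷ : ℕ → Word A → Word A
  dropʷ zero    w = w
  dropʷ (suc k) w = dropʷ k (tailʷ w)

  ≤ʷ-◁ : (σ τ : Word A) → σ ≤ʷ σ ◁ τ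
  ≤ʷ-◁ σ τ i x σi rewrite σi = refl

  ◁-absorb : {σ τ : Word A} → σ ≤ʷ τ → σ ◁ τ ≈ʷ τ
  ◁-absorb {σ} σ≤τ i with at σ i in σi
  ... | just x  = sym (σ≤τ i x σi)
  ... | nothing = refl

  ◁-finite : (σ τ : Word A) → Finite σ → Finite τ → Finite (σ ◁ τ)
  ◁-finite σ τ (n , σn) (m , τm) = m + n , ended
    where
    ended : at σ (m + n) <∣> at τ (m + n) ≡ nothing
    ended rewrite at-nothing-+ σ m σn | +-comm m n = at-nothing-+ τ n τm

  ◁-congˡ : {σ σ' : Word A} (τ : Word A) → σ ≈ʷ σ' → σ ◁ τ ≈ʷ σ' ◁ τ
  ◁-congˡ τ σ≈σ' i = cong (_<∣> at τ i) (σ≈σ' i)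

  ⊙-congʳ : (α : List A) {γ γ' : Word A} → γ ≈ʷ γ' → (α ⊙ γ) ≈ʷ (α ⊙ γ')
  ⊙-congʳ []      γ≈γ' i       = γ≈γ' i
  ⊙-congʳ (x ∷ α) γ≈γ' zero    = refl
  ⊙-congʳ (x ∷ α) γ≈γ' (suc i) = ⊙-congʳ α γ≈γ' i

  ⊙-◁ : (α : List A) (γ τ : Word A) → (α ⊙ γ) ◁ τ ≈ʷ (α ⊙ γ ◁ dropʷ (length α) τ)
  ⊙-◁ []      γ τ i       = refl
  ⊙-◁ (x ∷ α) γ τ zero    = refl
  ⊙-◁ (x ∷ α) γ τ (suc i) = ⊙-◁ α γ (tailʷ τ) i

  ◁-⊙-⊙ : {σ : Word A} (α L : List A) (β τ : Word A) → σ ≈ʷ (α ⊙ L ⊙ β) →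
          σ ◁ τ ≈ʷ (α ⊙ L ⊙ β ◁ dropʷ (length L) (dropʷ (length α) τ))
  ◁-⊙-⊙ {σ} α L β τ σ≈ i = begin
    at (σ ◁ τ) i                               ≡⟨ ◁-congˡ {σ} {α ⊙ L ⊙ β} τ σ≈ i ⟩
    at ((α ⊙ L ⊙ β) ◁ τ) i                     ≡⟨ ⊙-◁ α (L ⊙ β) τ i ⟩
    at (α ⊙ ((L ⊙ β) ◁ dropʷ (length α) τ)) i  ≡⟨ ⊙-congʳ α (⊙-◁ L β (dropʷ (length α) τ)) i ⟩
    at (α ⊙ L ⊙ (β ◁ dropʷ (length L) (dropʷ (length α) τ))) i ∎
    where open ≡-Reasoning

module _ (N : Net) where
  open Net N

  Step-resp : ∀ {M₁ M₂ M₁' M₂' t G} → M₁ ≗ M₂ → M₁' ≗ M₂' →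
              Step N M₁ t G M₁' → Step N M₂ t G M₂'
  Step-resp {t = t} {G} M₁≗M₂ M₁'≗M₂' (enabled , fired) =
    (λ s → subst (preM N (t ∷ G) s ≤_) (M₁≗M₂ s) (enabled s)) ,
    (λ s → trans (sym (M₁'≗M₂' s))
                 (trans (fired s) (cong (λ m → m ∸ preM N (t ∷ G) s + postM N (t ∷ G) s) (M₁≗M₂ s))))

  Step-deterministic : ∀ {M M' M₁ M₂ t G} → M ≗ M' →
                       Step N M t G M₁ → Step N M' t G M₂ → M₁ ≗ M₂
  Step-deterministic {t = t} {G} M≗M' (_ , fired₁) (_ , fired₂) s =
    trans (fired₁ s)
          (trans (cong (λ m → m ∸ preM N (t ∷ G) s + postM N (t ∷ G) s) (M≗M' s)) (sym (fired₂ s)))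

  Run-deterministic : ∀ {M M' M₁ M₂ α} → M ≗ M' → Run N M α M₁ → Run N M' α M₂ → M₁ ≗ M₂
  Run-deterministic M≗M' (run[] M≗M₁) (run[] M'≗M₂) s =
    trans (sym (M≗M₁ s)) (trans (M≗M' s) (M'≗M₂ s))
  Run-deterministic M≗M' (run∷ step₁ run₁) (run∷ step₂ run₂) =
    Run-deterministic (Step-deterministic {G = []} M≗M' step₁ step₂) run₁ run₂

  Fires-respˡ : ∀ {M M' σ} → M ≗ M' → Fires N M σ → Fires N M' σ
  Fires-respˡ M≗M' (Ms , start , steps) = Ms , (λ s → trans (start s) (M≗M' s)) , steps

  Fires-respʳ : ∀ {M σ ρ} → σ ≈ʷ ρ → Fires N M σ → Fires N M ρ
  Fires-respʳ σ≈ρ (Ms , start , steps) = Ms , start , λ i t ρi → steps i t (trans (σ≈ρ i) ρi)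

  Fires-⊙⁻ : ∀ {M} α γ → Fires N M (α ⊙ γ) → Σ (Marking N) λ M₁ → Run N M α M₁ × Fires N M₁ γ
  Fires-⊙⁻ []      γ fires = _ , run[] (λ _ → refl) , fires
  Fires-⊙⁻ (t ∷ α) γ (Ms , start , steps)
    with M₁ , run , fires ← Fires-⊙⁻ α γ ((λ i → Ms (suc i)) , (λ _ → refl) , (λ i → steps (suc i))) =
    M₁ , run∷ (Step-resp {G = []} start (λ _ → refl) (steps 0 t refl)) run , fires

  Fires-⊙⁺ : ∀ {M M₁ α γ} → Run N M α M₁ → Fires N M₁ γ → Fires N M (α ⊙ γ)
  Fires-⊙⁺ {γ = γ} (run[] M≗M₁) = Fires-respˡ {σ = γ} (λ s → sym (M≗M₁ s))
  Fires-⊙⁺ {M} {α = t ∷ α} {γ} (run∷ step run) fires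
    with Ms , start , steps ← Fires-⊙⁺ run fires = Ms' , (λ _ → refl) , steps'
    where
    Ms' : ℕ → Marking N
    Ms' zero    = M
    Ms' (suc i) = Ms i
    steps' : ∀ i t' → at ((t ∷ α) ⊙ γ) i ≡ just t' → Step N (Ms' i) t' [] (Ms' (suc i))
    steps' zero    .t refl = Step-resp {G = []} (λ _ → refl) (λ s → sym (start s)) step
    steps' (suc i) = steps i

  Run-exchange : ∀ {M M₂ t u} → (∀ s → preM N (t ∷ u ∷ []) s ≤ M s) →
             Run N M (u ∷ t ∷ []) M₂ → Run N M (t ∷ u ∷ []) M₂
  Run-exchange {M} {M₂} {t} {u} enabled
    (run∷ {M' = Mu} (_ , fired-u) (run∷ {M' = Mut} (_ , fired-t) (run[] end))) =
    run∷ (t-enabled , λ _ → refl) (run∷ (u-enabled , fired-ut) (run[] λ _ → refl))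
    where
    pt pu qt qu : S → ℕ
    pt = preM N (t ∷ [])
    pu = preM N (u ∷ [])
    qt = postM N (t ∷ [])
    qu = postM N (u ∷ [])
    Mt : Marking N
    Mt s = M s ∸ pt s + qt s
    both-enabled : ∀ s → pt s + pu s ≤ M s
    both-enabled s = subst (_≤ M s) (cong (_+ pu s) (sym (+-identityʳ (pre s t)))) (enabled s)
    t-enabled : ∀ s → pt s ≤ M s
    t-enabled s = m+n≤o⇒m≤o (pt s) (both-enabled s)
    u-enabled : ∀ s → pu s ≤ Mt s
    u-enabled s = ≤-trans (m+n≤o⇒n≤o∸m (pt s) (both-enabled s)) (m≤m+n _ (qt s))
    fired-ut : ∀ s → M₂ s ≡ Mt s ∸ pu s + qu s
    fired-ut s = begin
      M₂ s                             ≡⟨ end s ⟨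
      Mut s                            ≡⟨ fired-t s ⟩
      Mu s ∸ pt s + qt s               ≡⟨ cong (λ m → m ∸ pt s + qt s) (fired-u s) ⟩
      M s ∸ pu s + qu s ∸ pt s + qt s  ≡⟨ o∸n+q∸m+p≡o∸m+p∸n+q {pt s} {pu s} (qt s) (qu s) (both-enabled s) ⟩
      Mt s ∸ pu s + qu s               ∎
      where open ≡-Reasoning

  Fires-exchange : ∀ {M₀' M α t u} β → Run N M₀' α M → (∀ s → preM N (t ∷ u ∷ []) s ≤ M s) →
                   Fires N M₀' (α ⊙ (u ∷ t ∷ []) ⊙ β) → Fires N M₀' (α ⊙ (t ∷ u ∷ []) ⊙ β)
  Fires-exchange {α = α} {t} {u} β run enabled fires
    with M₁ , run₁ , fires₁ ← Fires-⊙⁻ α _ fires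
    with _ , ut-run , rest ← Fires-⊙⁻ (u ∷ t ∷ []) β fires₁ =
    Fires-⊙⁺ run₁ (Fires-⊙⁺ (Run-exchange enabled₁ ut-run) rest)
    where
    enabled₁ : ∀ s → preM N (t ∷ u ∷ []) s ≤ M₁ s
    enabled₁ s = subst (_ ≤_) (Run-deterministic (λ _ → refl) run run₁ s) (enabled s)

  ≡₀-◁ : ∀ {σ ρ} τ → _≡₀_ N σ ρ → FS∞ N (ρ ◁ τ) → _≡₀_ N (σ ◁ τ) (ρ ◁ τ)
  ≡₀-◁ {σ} {ρ} τ (_ , _ , α , t , u , β , σ≈ , ρ≈ , M , run , M' , tu-step) ρ◁τ-fires =
    σ◁τ-fires , ρ◁τ-fires , α , t , u , β' , σ◁τ≈ , ρ◁τ≈ , M , run , M' , tu-step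
    where
    β' : Word T
    β' = β ◁ dropʷ 2 (dropʷ (length α) τ)
    σ◁τ≈ : σ ◁ τ ≈ʷ (α ⊙ (t ∷ u ∷ []) ⊙ β')
    σ◁τ≈ = ◁-⊙-⊙ {σ = σ} α (t ∷ u ∷ []) β τ σ≈
    ρ◁τ≈ : ρ ◁ τ ≈ʷ (α ⊙ (u ∷ t ∷ []) ⊙ β')
    ρ◁τ≈ = ◁-⊙-⊙ {σ = ρ} α (u ∷ t ∷ []) β τ ρ≈
    -- Words are only constrained pointwise here, which leaves their `closed`
    -- field undetermined, so the word arguments have to be given explicitly.
    σ◁τ-fires : FS∞ N (σ ◁ τ)
    σ◁τ-fires =
      Fires-respʳ {σ = α ⊙ (t ∷ u ∷ []) ⊙ β'} {σ ◁ τ} (≈ʷ-sym {σ = σ ◁ τ} {α ⊙ (t ∷ u ∷ []) ⊙ β'} σ◁τ≈)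
        (Fires-exchange β' run (proj₁ tu-step)
          (Fires-respʳ {σ = ρ ◁ τ} {α ⊙ (u ∷ t ∷ []) ⊙ β'} ρ◁τ≈ ρ◁τ-fires))

  ≡₀*-FS∞ˡ : ∀ {σ ρ} → _≡₀*_ N σ ρ → FS∞ N σ
  ≡₀*-FS∞ˡ (refl* σ-fires _)      = σ-fires
  ≡₀*-FS∞ˡ (step* (σ-fires , _) _) = σ-fires

  ≡₀*-◁ : ∀ {σ ρ τ} → _≡₀*_ N σ ρ → ρ ≤ʷ τ → FS∞ N τ → _≡₀*_ N (σ ◁ τ) τ
  ≡₀*-◁ {σ} {τ = τ} (refl* _ σ≈ρ) ρ≤τ τ-fires =
    refl* (Fires-respʳ {σ = τ} {σ ◁ τ} (≈ʷ-sym {σ = σ ◁ τ} {τ} σ◁τ≈τ) τ-fires) σ◁τ≈τ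
    where
    σ◁τ≈τ : σ ◁ τ ≈ʷ τ
    σ◁τ≈τ = ◁-absorb {σ = σ} {τ} (λ i x σi → ρ≤τ i x (trans (sym (σ≈ρ i)) σi))
  ≡₀*-◁ {σ} {τ = τ} (step* {ρ = ρ} σ≡₀ρ ρ≡₀*) ρ≤τ τ-fires =
    step* (≡₀-◁ {σ} {ρ} τ σ≡₀ρ (≡₀*-FS∞ˡ ρ◁τ≡₀*τ)) ρ◁τ≡₀*τ
    where ρ◁τ≡₀*τ = ≡₀*-◁ ρ≡₀* ρ≤τ τ-fires

corollary1 : (N : Net) (σ₁ σ₂ σ₃ : Word (Net.T N)) →
    FS N σ₁ → FS N σ₂ → FS∞ N σ₃ →
    _≡₀*_ N σ₁ σ₂ → σ₂ ≤ʷ σ₃ →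
    Σ (Word (Net.T N)) λ σ' →
      FS∞ N σ' × σ₁ ≤ʷ σ' × _≡₀*_ N σ' σ₃ × (FS N σ₃ → FS N σ')
corollary1 N σ₁ σ₂ σ₃ (_ , σ₁-finite) _ σ₃-fires σ₁≡₀*σ₂ σ₂≤σ₃ =
  σ₁ ◁ σ₃ , ≡₀*-FS∞ˡ N chain , ≤ʷ-◁ σ₁ σ₃ , chain ,
  λ (_ , σ₃-finite) → ≡₀*-FS∞ˡ N chain , ◁-finite σ₁ σ₃ σ₁-finite σ₃-finite
  where
  chain : _≡₀*_ N (σ₁ ◁ σ₃) σ₃
  chain = ≡₀*-◁ N σ₁≡₀*σ₂ σ₂≤σ₃ σ₃-fires
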